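{- Let $(K,v)$ be a henselian nontrivially valued field of characteristic exponent $p$ with value group $\Gamma_v$. Let $n<\omega$, let $a\in K^{(p^{n})}$, and let $\alpha\in\Gamma_{v}$. Then $$K^{(p^{n})}=\left\{\frac{x-a}{y-a}\;\middle|\;x,y\in B(\alpha;a)\cap K^{(p^{n})},\ y\neq a\right\}.$$
   Context: $B(\alpha;a)=\{x\in K\mid v(x-a)>\alpha\}$; $K^{(p^n)}=\{x^{p^n}\mid x\in K\}$; the characteristic exponent $p$ is the characteristic if positive and $1$ otherwise. -}

module Defs where

open import Level using (Level; _⊔_) renaming (suc to lsuc)
open import Algebra.Bundles using (CommutativeRing; AbelianGroup)
open import Data.Nat as ℕ using (ℕ; zero; suc)
open import Data.Nat.Primality using (Prime)
open import Data.List using (List; []; _∷_)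
open import Data.List.Relation.Unary.All using (All)
open import Data.Product using (Σ; ∃; ∃-syntax; _×_; _,_)
open import Data.Sum using (_⊎_)
open import Data.Unit.Polymorphic using (⊤)
open import Data.Empty.Polymorphic using (⊥)
open import Relation.Nullary using (¬_)
open import Relation.Binary.Core using (Rel)
open import Relation.Binary.PropositionalEquality using (_≡_)
open import Relation.Binary.Structures using (IsTotalOrder)

record Field (c ℓ : Level) : Set (lsuc (c ⊔ ℓ)) where
  field
    commutativeRing : CommutativeRing c ℓ
  open CommutativeRing commutativeRing public
  field
    0≉1     : ¬ (0# ≈ 1#)
    inverse : ∀ x → ¬ (x ≈ 0#) → ∃[ y ] (x * y ≈ 1#)

-- Totally ordered abelian groups (written additively via _∙_ / ε / _⁻¹).

record OrderedAbelianGroup (c ℓ₁ ℓ₂ : Level) : Set (lsuc (c ⊔ ℓ₁ ⊔ ℓ₂)) where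
  field
    abelianGroup : AbelianGroup c ℓ₁
  open AbelianGroup abelianGroup public
  field
    _≤_          : Rel Carrier ℓ₂
    isTotalOrder : IsTotalOrder _≈_ _≤_
    ∙-monoˡ-≤    : ∀ {a b} d → a ≤ b → (a ∙ d) ≤ (b ∙ d)

  _<_ : Rel Carrier (ℓ₁ ⊔ ℓ₂)
  a < b = (a ≤ b) × ¬ (a ≈ b)

data Ext {c} (A : Set c) : Set c where
  fin : A → Ext A
  ∞   : Ext A

module ExtOps {c ℓ₁ ℓ₂} (Γ : OrderedAbelianGroup c ℓ₁ ℓ₂) where
  open OrderedAbelianGroup Γ

  _≈∞_ : Ext Carrier → Ext Carrier → Set ℓ₁
  fin a ≈∞ fin b = a ≈ b
  fin a ≈∞ ∞     = ⊥
  ∞     ≈∞ fin b = ⊥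
  ∞     ≈∞ ∞     = ⊤

  _≤∞_ : Ext Carrier → Ext Carrier → Set ℓ₂
  fin a ≤∞ fin b = a ≤ b
  fin a ≤∞ ∞     = ⊤
  ∞     ≤∞ fin b = ⊥
  ∞     ≤∞ ∞     = ⊤

  _<∞_ : Ext Carrier → Ext Carrier → Set (ℓ₁ ⊔ ℓ₂)
  fin a <∞ fin b = a < b
  fin a <∞ ∞     = ⊤
  ∞     <∞ _     = ⊥

  _+∞_ : Ext Carrier → Ext Carrier → Ext Carrier
  fin a +∞ fin b = fin (a ∙ b)
  fin a +∞ ∞     = ∞
  ∞     +∞ _     = ∞

module FieldOps {c ℓ} (K : Field c ℓ) where
  open Field K

  natMul : ℕ → Carrier → Carrier
  natMul zero    x = 0#
  natMul (suc n) x = x + natMul n x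

  pow : Carrier → ℕ → Carrier
  pow x zero    = 1#
  pow x (suc n) = x * pow x n

  -- polynomials as coefficient lists, constant term first
  eval : List Carrier → Carrier → Carrier
  eval []       x = 0#
  eval (c ∷ cs) x = c + x * eval cs x

  derivAux : ℕ → List Carrier → List Carrier
  derivAux k []       = []
  derivAux k (c ∷ cs) = natMul k c ∷ derivAux (suc k) cs

  deriv : List Carrier → List Carrier
  deriv []       = []
  deriv (c ∷ cs) = derivAux 1 cs

  CharExp : ℕ → Set ℓ
  CharExp p = ((p ≡ 1) × (∀ m → ¬ (natMul (suc m) 1# ≈ 0#)))
            ⊎ (Prime p × (natMul p 1# ≈ 0#))

  InPowers : ℕ → Carrier → Set (c ⊔ ℓ)
  InPowers m z = ∃[ y ] (pow y m ≈ z)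

record Valuation {c ℓ c' ℓ₁ ℓ₂} (K : Field c ℓ)
                 (Γ : OrderedAbelianGroup c' ℓ₁ ℓ₂)
                 : Set (c ⊔ ℓ ⊔ c' ⊔ ℓ₁ ⊔ ℓ₂) where
  private
    module K = Field K
    module Γ = OrderedAbelianGroup Γ
  open ExtOps Γ
  field
    v       : K.Carrier → Ext Γ.Carrier
    v-cong  : ∀ {x y} → x K.≈ y → v x ≈∞ v y
    v-∞⇒0   : ∀ x → v x ≈∞ ∞ → x K.≈ K.0#
    v-0⇒∞   : ∀ x → x K.≈ K.0# → v x ≈∞ ∞
    v-mul   : ∀ x y → v (x K.* y) ≈∞ (v x +∞ v y)
    -- min (v x , v y) ≤ v (x + y)
    v-add   : ∀ x y → (v x ≤∞ v (x K.+ y)) ⊎ (v y ≤∞ v (x K.+ y))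
    -- Γ is the value group Γ_v = v(K^×)
    v-surj  : ∀ γ → ∃[ x ] (v x ≈∞ fin γ)

module ValuationOps {c ℓ c' ℓ₁ ℓ₂} {K : Field c ℓ}
                    {Γ : OrderedAbelianGroup c' ℓ₁ ℓ₂}
                    (V : Valuation K Γ) where
  open Field K
  open OrderedAbelianGroup Γ using (ε) renaming (Carrier to G; _≈_ to _≈ᵍ_)
  open ExtOps Γ
  open FieldOps K
  open Valuation V

  InO : Carrier → Set ℓ₂
  InO x = fin ε ≤∞ v x

  Nontrivial : Set (c' ⊔ ℓ₁)
  Nontrivial = ∃[ γ ] ¬ (γ ≈ᵍ ε)

  Henselian : Set (c ⊔ ℓ ⊔ ℓ₁ ⊔ ℓ₂)
  Henselian = ∀ (f : List Carrier) → All InO f →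
              ∀ a → InO a →
              fin ε <∞ v (eval f a) →
              v (eval (deriv f) a) ≈∞ fin ε →
              ∃[ b ] (InO b × (eval f b ≈ 0#) × (fin ε <∞ v (b - a)))

  InBall : G → Carrier → Carrier → Set (ℓ₁ ⊔ ℓ₂)
  InBall α a x = fin α <∞ v (x - a)

  InQuotientSet : ℕ → G → Carrier → Carrier → Set (c ⊔ ℓ ⊔ ℓ₁ ⊔ ℓ₂)
  InQuotientSet m α a z =
    ∃[ x ] ∃[ y ] ( InBall α a x × InPowers m x
                  × InBall α a y × InPowers m y
                  × ¬ (y ≈ a)
                  × (z * (y - a) ≈ x - a) )

module Submission where

-- Let q = p ^ n, where p is the characteristic exponent of K.  The proof
-- uses only two facts about q: it is positive, and x ↦ x ^ q is additive
-- (the Frobenius endomorphism, or the identity when p = 1).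
--
-- (⊆) If z = w ^ q and a = a' ^ q, choose r of large positive value and put
--     x = (a' + w r) ^ q, y = (a' + r) ^ q.  By additivity
--     x - a = z r ^ q and y - a = r ^ q, so z (y - a) = x - a, and both
--     x, y lie in B(α; a) once v(r ^ q) exceeds α and α - v z.
-- (⊇) If z (y - a) = x - a with x = x' ^ q, y = y' ^ q, a = a' ^ q, then
--     by additivity z = ((x' - a') / (y' - a')) ^ q.

open import Defs
open import Level using (lift; lower)
open import Algebra.Bundles using (CommutativeRing)
open import Data.Nat as ℕ using (ℕ; zero; suc; _^_; _!; NonZero)
import Data.Nat.Properties as ℕ
open import Data.Nat.Combinatorics using (_C_; nCn≡1; k![n∸k]!∣n!)
open import Data.Nat.Combinatorics.Specification using (nCk≡n!/k![n-k]!)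
open import Data.Nat.Divisibility using (_∣_; divides; ∣⇒≤; m∣m*n)
open import Data.Nat.DivMod using (m/n*n≡m)
open import Data.Nat.Primality
  using (Prime; euclidsLemma; prime⇒nonZero; prime⇒nonTrivial; ¬prime[0])
open import Data.Fin as Fin using (Fin; toℕ; inject₁; fromℕ)
open import Data.Fin.Properties using (toℕ-fromℕ; toℕ-inject₁; toℕ<n)
open import Data.Product using (∃-syntax; _×_; _,_; proj₁; proj₂)
open import Data.Sum using (inj₁; inj₂)
open import Data.Unit.Polymorphic using (tt)
open import Relation.Nullary using (¬_; contradiction)
open import Relation.Binary.Bundles using (Setoid; TotalOrder)
open import Relation.Binary.Structures using (IsEquivalence)
import Relation.Binary.Reasoning.PartialOrder
import Relation.Binary.Reasoning.Setoid
import Relation.Binary.PropositionalEquality as P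

prime∤factorial : ∀ {p} → Prime p → ∀ m → m ℕ.< p → ¬ (p ∣ m !)
prime∤factorial {p} p-prime zero    _   p∣1 =
  ℕ.<⇒≱ (ℕ.nonTrivial⇒n>1 p {{prime⇒nonTrivial p-prime}}) (∣⇒≤ p∣1)
prime∤factorial {p} p-prime (suc m) m<p p∣m! with euclidsLemma (suc m) (m !) p-prime p∣m!
... | inj₁ p∣1+m = ℕ.<⇒≱ m<p (∣⇒≤ p∣1+m)
... | inj₂ p∣m!  = prime∤factorial p-prime m (ℕ.<-trans (ℕ.n<1+n m) m<p) p∣m!

binomial*factorials≡factorial : ∀ {n k} → k ℕ.≤ n → (n C k) ℕ.* (k ! ℕ.* (n ℕ.∸ k) !) P.≡ n !
binomial*factorials≡factorial {n} {k} k≤n = begin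
  (n C k) ℕ.* (k ! ℕ.* (n ℕ.∸ k) !)                       ≡⟨ P.cong (ℕ._* (k ! ℕ.* (n ℕ.∸ k) !)) (nCk≡n!/k![n-k]! k≤n) ⟩
  (n ! ℕ./ (k ! ℕ.* (n ℕ.∸ k) !)) ℕ.* (k ! ℕ.* (n ℕ.∸ k) !) ≡⟨ m/n*n≡m (k![n∸k]!∣n! k≤n) ⟩
  n !                                                      ∎
  where
  open P.≡-Reasoning
  instance _ = k ℕ.!* (n ℕ.∸ k) !≢0

-- p divides p! = (p C k) · k! · (p - k)! but, by Euclid's lemma, neither k!
-- nor (p - k)!; hence p ∣ p C k for 0 < k < p
prime∣binomial : ∀ {p k} → Prime p → 0 ℕ.< k → k ℕ.< p → p ∣ p C k
prime∣binomial {p@(suc p-1)} {k} p-prime 0<k k<p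
  with euclidsLemma (p C k) (k ! ℕ.* (p ℕ.∸ k) !) p-prime
         (P.subst (p ∣_) (P.sym (binomial*factorials≡factorial k≤p)) (m∣m*n (p-1 !)))
  where k≤p = ℕ.<⇒≤ k<p
... | inj₁ p∣pCk = p∣pCk
... | inj₂ p∣k![p-k]! with euclidsLemma (k !) ((p ℕ.∸ k) !) p-prime p∣k![p-k]!
...   | inj₁ p∣k!     = contradiction p∣k! (prime∤factorial p-prime k k<p)
...   | inj₂ p∣[p-k]! = contradiction p∣[p-k]!
                          (prime∤factorial p-prime (p ℕ.∸ k) (ℕ.∸-monoʳ-< 0<k (ℕ.<⇒≤ k<p)))

module AdditiveExponents {c ℓ} (R : CommutativeRing c ℓ) where
  open CommutativeRing R
  open import Algebra.Properties.Semiring.Exp semiring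
    using (^-congˡ; ^-congʳ; ^-assocʳ) renaming (_^_ to _^ᴿ_)
  open import Algebra.Properties.Semiring.Mult semiring
    using (×-congˡ; ×-congʳ; ×-homo-1; ×-assoc-*; ×1-homo-*) renaming (_×_ to _·_)
  open import Algebra.Properties.Semiring.Sum semiring
    using (sum; sum-init-last; sum-cong-≋; sum-replicate-zero)
  open import Algebra.Properties.CommutativeSemiring.Binomial commutativeSemiring
    using (theorem; binomialTerm; binomialExpansion)
  open import Relation.Binary.Reasoning.Setoid setoid

  Additive : ℕ → Set (c Level.⊔ ℓ)
  Additive q = ∀ x y → (x + y) ^ᴿ q ≈ x ^ᴿ q + y ^ᴿ q

  additive-1 : Additive 1
  additive-1 x y = trans (*-identityʳ (x + y)) (+-cong (sym (*-identityʳ x)) (sym (*-identityʳ y)))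

  additive-* : ∀ {a b} → Additive a → Additive b → Additive (a ℕ.* b)
  additive-* {a} {b} add-a add-b x y = begin
    (x + y) ^ᴿ (a ℕ.* b)               ≈⟨ ^-assocʳ (x + y) a b ⟨
    ((x + y) ^ᴿ a) ^ᴿ b                ≈⟨ ^-congˡ b (add-a x y) ⟩
    (x ^ᴿ a + y ^ᴿ a) ^ᴿ b             ≈⟨ add-b (x ^ᴿ a) (y ^ᴿ a) ⟩
    (x ^ᴿ a) ^ᴿ b + (y ^ᴿ a) ^ᴿ b      ≈⟨ +-cong (^-assocʳ x a b) (^-assocʳ y a b) ⟩
    x ^ᴿ (a ℕ.* b) + y ^ᴿ (a ℕ.* b)    ∎

  additive-^ : ∀ {a} → Additive a → ∀ n → Additive (a ℕ.^ n)
  additive-^         add-a zero    = additive-1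
  additive-^ {a} add-a (suc n) = additive-* {a} {a ℕ.^ n} add-a (additive-^ add-a n)

  module _ {m} (p-prime : Prime (suc m)) (char : suc m · 1# ≈ 0#) where
    private p = suc m

    multiple-of-char : ∀ d x → (d ℕ.* p) · x ≈ 0#
    multiple-of-char d x = begin
      (d ℕ.* p) · x               ≈⟨ ×-congʳ (d ℕ.* p) (*-identityˡ x) ⟨
      (d ℕ.* p) · (1# * x)        ≈⟨ ×-assoc-* (d ℕ.* p) 1# x ⟨
      ((d ℕ.* p) · 1#) * x        ≈⟨ *-congʳ (×1-homo-* d p) ⟩
      ((d · 1#) * (p · 1#)) * x   ≈⟨ *-congʳ (*-congˡ char) ⟩
      ((d · 1#) * 0#) * x         ≈⟨ *-congʳ (zeroʳ (d · 1#)) ⟩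
      0# * x                      ≈⟨ zeroˡ x ⟩
      0#                          ∎

    inner-binomial≈0 : ∀ k t → 0 ℕ.< k → k ℕ.< p → (p C k) · t ≈ 0#
    inner-binomial≈0 k t 0<k k<p with prime∣binomial p-prime 0<k k<p
    ... | divides d pCk≡d*p = trans (×-congˡ pCk≡d*p) (multiple-of-char d t)

    -- (x + y) ^ p = Σ_k (p C k) x^k y^(p-k), and only k = 0 and k = p survive
    frobenius-suc : Additive p
    frobenius-suc x y = begin
      (x + y) ^ᴿ p                                  ≈⟨ theorem p x y ⟩
      binomialExpansion x y p                       ≡⟨⟩
      term Fin.zero + sum (λ i → term (Fin.suc i))  ≈⟨ +-congˡ (sum-init-last (λ i → term (Fin.suc i))) ⟩
      term Fin.zero + (sum inner + term (Fin.suc (fromℕ m)))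
        ≈⟨ +-cong first-term (+-cong inner-sum≈0 last-term) ⟩
      y ^ᴿ p + (0# + x ^ᴿ p)                        ≈⟨ +-congˡ (+-identityˡ (x ^ᴿ p)) ⟩
      y ^ᴿ p + x ^ᴿ p                               ≈⟨ +-comm (y ^ᴿ p) (x ^ᴿ p) ⟩
      x ^ᴿ p + y ^ᴿ p                               ∎
      where
      term : Fin (suc p) → Carrier
      term = binomialTerm x y p

      inner : Fin m → Carrier
      inner i = term (Fin.suc (inject₁ i))

      first-term : term Fin.zero ≈ y ^ᴿ p
      first-term = trans (×-homo-1 (1# * y ^ᴿ p)) (*-identityˡ (y ^ᴿ p))

      inner-sum≈0 : sum inner ≈ 0#
      inner-sum≈0 = trans (sum-cong-≋ (λ i → inner-binomial≈0 (suc (toℕ (inject₁ i))) _ (ℕ.s≤s ℕ.z≤n)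
                                            (ℕ.s≤s (P.subst (ℕ._< m) (P.sym (toℕ-inject₁ i)) (toℕ<n i)))))
                          (sum-replicate-zero m)

      last-term : term (Fin.suc (fromℕ m)) ≈ x ^ᴿ p
      last-term = begin
        (p C suc (toℕ (fromℕ m))) · (x ^ᴿ suc (toℕ (fromℕ m)) * y ^ᴿ (p ℕ.∸ suc (toℕ (fromℕ m))))
          ≡⟨ P.cong (λ j → (p C j) · (x ^ᴿ j * y ^ᴿ (p ℕ.∸ j))) (P.cong suc (toℕ-fromℕ m)) ⟩
        (p C p) · (x ^ᴿ p * y ^ᴿ (p ℕ.∸ p))   ≈⟨ ×-congˡ (nCn≡1 p) ⟩
        1 · (x ^ᴿ p * y ^ᴿ (p ℕ.∸ p))         ≈⟨ ×-homo-1 _ ⟩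
        x ^ᴿ p * y ^ᴿ (p ℕ.∸ p)               ≈⟨ *-congˡ (^-congʳ y (ℕ.n∸n≡0 p)) ⟩
        x ^ᴿ p * 1#                           ≈⟨ *-identityʳ (x ^ᴿ p) ⟩
        x ^ᴿ p                                ∎

  frobenius : ∀ {p} → Prime p → p · 1# ≈ 0# → Additive p
  frobenius {zero}  p-prime _    = contradiction p-prime ¬prime[0]
  frobenius {suc m} p-prime char = frobenius-suc p-prime char

-- Powers in a field.  `pow` and `natMul` of Defs agree with the library's
-- operations; we work with the latter and translate at the boundary.

module FieldPowers {c ℓ} (K : Field c ℓ) where
  open Field K
  open FieldOps K
  open AdditiveExponents commutativeRing public using (Additive)
  open AdditiveExponents commutativeRing using (additive-1; additive-^; frobenius)
  open import Algebra.Properties.Semiring.Exp semiring using (^-congˡ) renaming (_^_ to _^ᴿ_)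
  open import Algebra.Properties.CommutativeSemiring.Exp commutativeSemiring using (^-distrib-*)
  open import Algebra.Properties.Semiring.Mult semiring using () renaming (_×_ to _·_)
  open import Algebra.Properties.AbelianGroup +-abelianGroup
    using (x∙y⁻¹≈ε⇒x≈y; x≈z//y; //-rightDividesˡ; xyx⁻¹≈y)
  open import Relation.Binary.Reasoning.Setoid setoid

  pow≡^ : ∀ x n → pow x n P.≡ x ^ᴿ n
  pow≡^ x zero    = P.refl
  pow≡^ x (suc n) = P.cong (x *_) (pow≡^ x n)

  natMul≡· : ∀ n x → natMul n x P.≡ n · x
  natMul≡· zero    x = P.refl
  natMul≡· (suc n) x = P.cong (x +_) (natMul≡· n x)

  ^⇒InPowers : ∀ m y {z} → y ^ᴿ m ≈ z → InPowers m z
  ^⇒InPowers m y yᵐ≈z = y , trans (reflexive (pow≡^ y m)) yᵐ≈z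

  InPowers⇒^ : ∀ {m z} → InPowers m z → ∃[ y ] (y ^ᴿ m ≈ z)
  InPowers⇒^ {m} (y , yᵐ≈z) = y , trans (reflexive (P.sym (pow≡^ y m))) yᵐ≈z

  charExp-nonZero : ∀ {p} → CharExp p → NonZero p
  charExp-nonZero (inj₁ (P.refl , _))  = _
  charExp-nonZero (inj₂ (p-prime , _)) = prime⇒nonZero p-prime

  charExp-additive : ∀ {p} → CharExp p → ∀ n → Additive (p ℕ.^ n)
  charExp-additive (inj₁ (P.refl , _)) n =
    P.subst Additive (P.sym (ℕ.^-zeroˡ n)) additive-1
  charExp-additive {p} (inj₂ (p-prime , char)) =
    additive-^ (frobenius p-prime (P.subst (_≈ 0#) (natMul≡· p 1#) char))

  1^n≈1 : ∀ n → 1# ^ᴿ n ≈ 1#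
  1^n≈1 zero    = refl
  1^n≈1 (suc n) = trans (*-identityˡ (1# ^ᴿ n)) (1^n≈1 n)

  0^n≈0 : ∀ n .{{_ : NonZero n}} → 0# ^ᴿ n ≈ 0#
  0^n≈0 (suc n) = zeroˡ (0# ^ᴿ n)

  module _ {q} (additive : Additive q) where

    additive-sub : ∀ x y → (x - y) ^ᴿ q ≈ x ^ᴿ q - y ^ᴿ q
    additive-sub x y = x≈z//y ((x - y) ^ᴿ q) (y ^ᴿ q) (x ^ᴿ q) (begin
      (x - y) ^ᴿ q + y ^ᴿ q   ≈⟨ additive (x - y) y ⟨
      ((x - y) + y) ^ᴿ q      ≈⟨ ^-congˡ q (//-rightDividesˡ y x) ⟩
      x ^ᴿ q                  ∎)

    translate : ∀ {a a'} → a' ^ᴿ q ≈ a → ∀ t → (a' + t) ^ᴿ q - a ≈ t ^ᴿ q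
    translate {a} {a'} a'^q≈a t = begin
      (a' + t) ^ᴿ q - a                ≈⟨ +-cong (additive a' t) (-‿cong (sym a'^q≈a)) ⟩
      (a' ^ᴿ q + t ^ᴿ q) - a' ^ᴿ q     ≈⟨ xyx⁻¹≈y (a' ^ᴿ q) (t ^ᴿ q) ⟩
      t ^ᴿ q                           ∎

    difference-of-powers : ∀ {x x' a a'} → x' ^ᴿ q ≈ x → a' ^ᴿ q ≈ a → (x' - a') ^ᴿ q ≈ x - a
    difference-of-powers x'^q≈x a'^q≈a =
      trans (additive-sub _ _) (+-cong x'^q≈x (-‿cong a'^q≈a))

    quotient-of-powers : .{{_ : NonZero q}} → ∀ {x y a x' y' a' z} →
      x' ^ᴿ q ≈ x → y' ^ᴿ q ≈ y → a' ^ᴿ q ≈ a → ¬ (y ≈ a) → z * (y - a) ≈ x - a →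
      InPowers q z
    quotient-of-powers {x} {y} {a} {x'} {y'} {a'} {z} x'^q≈x y'^q≈y a'^q≈a y≉a z[y-a]≈x-a =
      ^⇒InPowers q ((x' - a') * d⁻¹) (begin
        ((x' - a') * d⁻¹) ^ᴿ q               ≈⟨ ^-distrib-* (x' - a') d⁻¹ q ⟩
        (x' - a') ^ᴿ q * d⁻¹ ^ᴿ q            ≈⟨ *-congʳ (difference-of-powers x'^q≈x a'^q≈a) ⟩
        (x - a) * d⁻¹ ^ᴿ q                   ≈⟨ *-congʳ z[y-a]≈x-a ⟨
        (z * (y - a)) * d⁻¹ ^ᴿ q             ≈⟨ *-assoc z (y - a) (d⁻¹ ^ᴿ q) ⟩
        z * ((y - a) * d⁻¹ ^ᴿ q)             ≈⟨ *-congˡ (*-congʳ dᵠ≈y-a) ⟨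
        z * (d ^ᴿ q * d⁻¹ ^ᴿ q)              ≈⟨ *-congˡ (^-distrib-* d d⁻¹ q) ⟨
        z * (d * d⁻¹) ^ᴿ q                   ≈⟨ *-congˡ (^-congˡ q d*d⁻¹≈1) ⟩
        z * 1# ^ᴿ q                          ≈⟨ *-congˡ (1^n≈1 q) ⟩
        z * 1#                               ≈⟨ *-identityʳ z ⟩
        z                                    ∎)
      where
      d = y' - a'
      dᵠ≈y-a : d ^ᴿ q ≈ y - a
      dᵠ≈y-a = difference-of-powers y'^q≈y a'^q≈a
      d≉0 : ¬ (d ≈ 0#)
      d≉0 d≈0 = y≉a (x∙y⁻¹≈ε⇒x≈y y a (trans (sym dᵠ≈y-a) (trans (^-congˡ q d≈0) (0^n≈0 q))))
      d⁻¹ = proj₁ (inverse d d≉0)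
      d*d⁻¹≈1 = proj₂ (inverse d d≉0)

module OrderedGroupProperties {c ℓ₁ ℓ₂} (Γ : OrderedAbelianGroup c ℓ₁ ℓ₂) where
  open OrderedAbelianGroup Γ
  open import Algebra.Properties.AbelianGroup abelianGroup
    using (∙-cancelˡ; xyx⁻¹≈y; ⁻¹-injective; ε⁻¹≈ε)

  totalOrder : TotalOrder c ℓ₁ ℓ₂
  totalOrder = record { isTotalOrder = isTotalOrder }

  open TotalOrder totalOrder using (poset; total; ≤-respˡ-≈; ≤-respʳ-≈)
    renaming (refl to ≤-refl)
  open import Relation.Binary.Reasoning.PartialOrder poset

  ∙-monoʳ-≤ : ∀ d {a b} → a ≤ b → (d ∙ a) ≤ (d ∙ b)
  ∙-monoʳ-≤ d {a} {b} a≤b = ≤-respʳ-≈ (comm b d) (≤-respˡ-≈ (comm a d) (∙-monoˡ-≤ d a≤b))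

  ∙-monoʳ-< : ∀ d {a b} → a < b → (d ∙ a) < (d ∙ b)
  ∙-monoʳ-< d {a} {b} (a≤b , a≉b) = ∙-monoʳ-≤ d a≤b , λ da≈db → a≉b (∙-cancelˡ d a b da≈db)

  x≤x∙y : ∀ x {y} → ε ≤ y → x ≤ (x ∙ y)
  x≤x∙y x ε≤y = ≤-respˡ-≈ (identityʳ x) (∙-monoʳ-≤ x ε≤y)

  x<x∙y : ∀ x {y} → ε < y → x < (x ∙ y)
  x<x∙y x {y} ε<y = begin-strict
    x       ≈⟨ identityʳ x ⟨
    x ∙ ε   <⟨ ∙-monoʳ-< x ε<y ⟩
    x ∙ y   ∎

  <-shift : ∀ h {α d} → (α ∙ h ⁻¹) < d → α < (h ∙ d)
  <-shift h {α} {d} α∙h⁻¹<d = begin-strict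
    α                 ≈⟨ xyx⁻¹≈y h α ⟨
    h ∙ α ∙ h ⁻¹      ≈⟨ assoc h α (h ⁻¹) ⟩
    h ∙ (α ∙ h ⁻¹)    <⟨ ∙-monoʳ-< h α∙h⁻¹<d ⟩
    h ∙ d             ∎

  positive-element : ∀ γ → ¬ (γ ≈ ε) → ∃[ e ] (ε < e)
  positive-element γ γ≉ε with total γ ε
  ... | inj₂ ε≤γ = γ , ε≤γ , λ ε≈γ → γ≉ε (sym ε≈γ)
  ... | inj₁ γ≤ε = γ ⁻¹ , ε≤γ⁻¹ , λ ε≈γ⁻¹ → γ≉ε (⁻¹-injective (trans (sym ε≈γ⁻¹) (sym ε⁻¹≈ε)))
    where
    ε≤γ⁻¹ : ε ≤ (γ ⁻¹)
    ε≤γ⁻¹ = begin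
      ε            ≈⟨ inverseˡ γ ⟨
      γ ⁻¹ ∙ γ     ≤⟨ ∙-monoʳ-≤ (γ ⁻¹) γ≤ε ⟩
      γ ⁻¹ ∙ ε     ≈⟨ identityʳ (γ ⁻¹) ⟩
      γ ⁻¹         ∎

  upper-bound : ∀ a b → ∃[ m ] (a ≤ m × b ≤ m)
  upper-bound a b with total a b
  ... | inj₁ a≤b = b , a≤b , ≤-refl
  ... | inj₂ b≤a = a , ≤-refl , b≤a

  strict-upper-bound : ∃[ e ] (ε < e) → ∀ a b d → ∃[ g ] (a < g × b < g × d < g)
  strict-upper-bound (e , ε<e) a b d =
    m ∙ e , below a≤m₁ , below b≤m₁ , (begin-strict d ≤⟨ d≤m ⟩ m <⟨ x<x∙y m ε<e ⟩ m ∙ e ∎)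
    where
    m₁  = proj₁ (upper-bound a b)
    a≤m₁ = proj₁ (proj₂ (upper-bound a b))
    b≤m₁ = proj₂ (proj₂ (upper-bound a b))
    m   = proj₁ (upper-bound m₁ d)
    m₁≤m = proj₁ (proj₂ (upper-bound m₁ d))
    d≤m = proj₂ (proj₂ (upper-bound m₁ d))
    below : ∀ {x} → x ≤ m₁ → x < (m ∙ e)
    below {x} x≤m₁ = begin-strict x ≤⟨ x≤m₁ ⟩ m₁ ≤⟨ m₁≤m ⟩ m <⟨ x<x∙y m ε<e ⟩ m ∙ e ∎

module ExtendedValues {c ℓ₁ ℓ₂} (Γ : OrderedAbelianGroup c ℓ₁ ℓ₂) where
  open OrderedAbelianGroup Γ
  open ExtOps Γ
  open OrderedGroupProperties Γ using (totalOrder; <-shift)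
  open TotalOrder totalOrder using (poset)
  open import Relation.Binary.Properties.Poset poset using (<-respʳ-≈)

  ≈∞-isEquivalence : IsEquivalence _≈∞_
  ≈∞-isEquivalence = record
    { refl  = λ {X} → ≈∞-refl {X}
    ; sym   = λ {X} {Y} → ≈∞-sym {X} {Y}
    ; trans = λ {X} {Y} {Z} → ≈∞-trans {X} {Y} {Z}
    }
    where
    ≈∞-refl : ∀ {X} → X ≈∞ X
    ≈∞-refl {fin a} = refl
    ≈∞-refl {∞}     = tt
    ≈∞-sym : ∀ {X Y} → X ≈∞ Y → Y ≈∞ X
    ≈∞-sym {fin a} {fin b} a≈b = sym a≈b
    ≈∞-sym {∞}     {∞}     _   = tt
    ≈∞-trans : ∀ {X Y Z} → X ≈∞ Y → Y ≈∞ Z → X ≈∞ Z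
    ≈∞-trans {fin a} {fin b} {fin d} a≈b b≈d = trans a≈b b≈d
    ≈∞-trans {∞}     {∞}     {∞}     _   _   = tt

  extSetoid : Setoid c ℓ₁
  extSetoid = record { isEquivalence = ≈∞-isEquivalence }

  +∞-cong : ∀ {X X' Y Y'} → X ≈∞ X' → Y ≈∞ Y' → (X +∞ Y) ≈∞ (X' +∞ Y')
  +∞-cong {fin a} {fin a'} {fin b} {fin b'} a≈a' b≈b' = ∙-cong a≈a' b≈b'
  +∞-cong {fin a} {fin a'} {∞}     {∞}     _    _     = tt
  +∞-cong {∞}     {∞}                      _    _     = tt

  +∞-congˡ : ∀ X {Y Y'} → Y ≈∞ Y' → (X +∞ Y) ≈∞ (X +∞ Y')
  +∞-congˡ X {Y} {Y'} = +∞-cong {X} {X} {Y} {Y'} (Setoid.refl extSetoid {X})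

  <∞-respʳ : ∀ {X Y Z} → X <∞ Y → Y ≈∞ Z → X <∞ Z
  <∞-respʳ {fin a} {fin b} {fin d} a<b b≈d = <-respʳ-≈ b≈d a<b
  <∞-respʳ {fin a} {∞}     {∞}     _   _   = tt

  eventually-above : ∀ α X → ∃[ β ] (∀ d → β < d → fin α <∞ (X +∞ fin d))
  eventually-above α (fin h) = α ∙ h ⁻¹ , λ d → <-shift h
  eventually-above α ∞       = α , λ _ _ → tt

module ValuationProperties {c ℓ c' ℓ₁ ℓ₂} {K : Field c ℓ}
                           {Γ : OrderedAbelianGroup c' ℓ₁ ℓ₂} (V : Valuation K Γ) where
  open Field K
  open Valuation V
  open ValuationOps V using (Nontrivial)
  open ExtOps Γ
  open ExtendedValues Γ using (extSetoid; +∞-cong)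
  module Γ = OrderedAbelianGroup Γ
  open OrderedGroupProperties Γ
    using (totalOrder; x≤x∙y; positive-element; strict-upper-bound)
  open TotalOrder totalOrder using (poset) renaming (refl to ≤-refl)
  module ≤-Reasoning = Relation.Binary.Reasoning.PartialOrder poset
  module ≈∞-Reasoning = Relation.Binary.Reasoning.Setoid extSetoid
  open import Algebra.Properties.Semiring.Exp semiring using () renaming (_^_ to _^ᴿ_)

  finite⇒nonzero : ∀ {x g} → v x ≈∞ fin g → ¬ (x ≈ 0#)
  finite⇒nonzero {x} {g} vx≈g x≈0 with v x | v-0⇒∞ x x≈0
  ... | fin _ | lift ()
  ... | ∞     | _      = lower vx≈g

  v-pow-≥ : ∀ {r g} → v r ≈∞ fin g → Γ.ε Γ.≤ g →
            ∀ n .{{_ : NonZero n}} → ∃[ d ] ((v (r ^ᴿ n) ≈∞ fin d) × (g Γ.≤ d))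
  v-pow-≥ {r} {g} vr≈g ε≤g 1 = g , v[r*1]≈g , ≤-refl
    where
    v[r*1]≈g : v (r * 1#) ≈∞ fin g
    v[r*1]≈g = begin v (r * 1#) ≈⟨ v-cong (*-identityʳ r) ⟩ v r ≈⟨ vr≈g ⟩ fin g ∎
      where open ≈∞-Reasoning
  v-pow-≥ {r} {g} vr≈g ε≤g (suc n@(suc _)) with v-pow-≥ vr≈g ε≤g n
  ... | d , vrⁿ≈d , g≤d = g Γ.∙ d , v[r*rⁿ]≈g∙d , g≤g∙d
    where
    v[r*rⁿ]≈g∙d : v (r * r ^ᴿ n) ≈∞ fin (g Γ.∙ d)
    v[r*rⁿ]≈g∙d = begin
      v (r * r ^ᴿ n)       ≈⟨ v-mul r (r ^ᴿ n) ⟩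
      v r +∞ v (r ^ᴿ n)    ≈⟨ +∞-cong {v r} {fin g} {v (r ^ᴿ n)} {fin d} vr≈g vrⁿ≈d ⟩
      fin (g Γ.∙ d)        ∎
      where open ≈∞-Reasoning
    g≤g∙d : g Γ.≤ (g Γ.∙ d)
    g≤g∙d = begin
      g          ≤⟨ g≤d ⟩
      d          ≤⟨ x≤x∙y d ε≤g ⟩
      d Γ.∙ g    ≈⟨ Γ.comm d g ⟩
      g Γ.∙ d    ∎
      where open ≤-Reasoning

  large-powers : Nontrivial → ∀ q .{{_ : NonZero q}} → ∀ α β →
                 ∃[ r ] ∃[ d ] ((v (r ^ᴿ q) ≈∞ fin d) × (α Γ.< d) × (β Γ.< d))
  large-powers (γ , γ≉ε) q α β with strict-upper-bound (positive-element γ γ≉ε) Γ.ε α β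
  ... | g , ε<g , α<g , β<g with v-surj g
  ...   | r , vr≈g with v-pow-≥ vr≈g (proj₁ ε<g) q
  ...     | d , vrᵠ≈d , g≤d =
    r , d , vrᵠ≈d , (begin-strict α <⟨ α<g ⟩ g ≤⟨ g≤d ⟩ d ∎) , (begin-strict β <⟨ β<g ⟩ g ≤⟨ g≤d ⟩ d ∎)
    where open ≤-Reasoning

module PowerQuotients {c ℓ c' ℓ₁ ℓ₂} {K : Field c ℓ} {Γ : OrderedAbelianGroup c' ℓ₁ ℓ₂}
                      (V : Valuation K Γ) {q : ℕ} .{{_ : NonZero q}}
                      (additive : FieldPowers.Additive K q) where
  open Field K
  open FieldOps K using (InPowers)
  open FieldPowers K using (^⇒InPowers; InPowers⇒^; translate; quotient-of-powers)
  open Valuation V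
  open ValuationOps V using (Nontrivial; InQuotientSet)
  open ValuationProperties V using (finite⇒nonzero; large-powers)
  open ExtOps Γ
  open ExtendedValues Γ using (extSetoid; +∞-congˡ; <∞-respʳ; eventually-above)
  open import Algebra.Properties.Semiring.Exp semiring using () renaming (_^_ to _^ᴿ_)
  open import Algebra.Properties.CommutativeSemiring.Exp commutativeSemiring using (^-distrib-*)
  open import Algebra.Properties.AbelianGroup +-abelianGroup using (x≈y⇒x∙y⁻¹≈ε)
  open import Relation.Binary.Reasoning.Setoid extSetoid

  powers⊆quotients : Nontrivial → ∀ α {a z} → InPowers q a → InPowers q z → InQuotientSet q α a z
  powers⊆quotients nontrivial α {a} {z} a∈Kᵠ z∈Kᵠ
    with InPowers⇒^ {q} a∈Kᵠ | InPowers⇒^ {q} z∈Kᵠ | eventually-above α (v z)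
  ... | a' , a'ᵠ≈a | w , wᵠ≈z | β , lifts-above-α
    with large-powers nontrivial q α β
  ... | r , d , v[rᵠ]≈d , α<d , β<d =
    x , y , x∈ball , ^⇒InPowers q (a' + w * r) refl , y∈ball , ^⇒InPowers q (a' + r) refl , y≉a , z[y-a]≈x-a
    where
    x = (a' + w * r) ^ᴿ q
    y = (a' + r) ^ᴿ q
    y-a≈rᵠ : y - a ≈ r ^ᴿ q
    y-a≈rᵠ = translate {q} additive a'ᵠ≈a r
    x-a≈z*rᵠ : x - a ≈ z * r ^ᴿ q
    x-a≈z*rᵠ = trans (translate {q} additive a'ᵠ≈a (w * r)) (trans (^-distrib-* w r q) (*-congʳ wᵠ≈z))
    y≉a : ¬ (y ≈ a)
    y≉a y≈a = finite⇒nonzero v[rᵠ]≈d (trans (sym y-a≈rᵠ) (x≈y⇒x∙y⁻¹≈ε y≈a))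
    z[y-a]≈x-a : z * (y - a) ≈ x - a
    z[y-a]≈x-a = trans (*-congˡ y-a≈rᵠ) (sym x-a≈z*rᵠ)
    y∈ball : fin α <∞ v (y - a)
    y∈ball = <∞-respʳ {fin α} {fin d} α<d (begin
      fin d            ≈⟨ v[rᵠ]≈d ⟨
      v (r ^ᴿ q)       ≈⟨ v-cong y-a≈rᵠ ⟨
      v (y - a)        ∎)
    x∈ball : fin α <∞ v (x - a)
    x∈ball = <∞-respʳ {fin α} {v z +∞ fin d} (lifts-above-α d β<d) (begin
      v z +∞ fin d           ≈⟨ +∞-congˡ (v z) v[rᵠ]≈d ⟨
      v z +∞ v (r ^ᴿ q)      ≈⟨ v-mul z (r ^ᴿ q) ⟨
      v (z * r ^ᴿ q)         ≈⟨ v-cong x-a≈z*rᵠ ⟨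
      v (x - a)              ∎)

  quotients⊆powers : ∀ α {a z} → InPowers q a → InQuotientSet q α a z → InPowers q z
  quotients⊆powers α a∈Kᵠ (x , y , _ , x∈Kᵠ , _ , y∈Kᵠ , y≉a , z[y-a]≈x-a)
    with InPowers⇒^ {q} a∈Kᵠ | InPowers⇒^ {q} x∈Kᵠ | InPowers⇒^ {q} y∈Kᵠ
  ... | a' , a'ᵠ≈a | x' , x'ᵠ≈x | y' , y'ᵠ≈y
    = quotient-of-powers {q} additive x'ᵠ≈x y'ᵠ≈y a'ᵠ≈a y≉a z[y-a]≈x-a

lemma4p11 : ∀ {c ℓ c' ℓ₁ ℓ₂}
  (K : Field c ℓ) (Γ : OrderedAbelianGroup c' ℓ₁ ℓ₂) (V : Valuation K Γ) →
  ValuationOps.Henselian V → ValuationOps.Nontrivial V →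
  (p : ℕ) → FieldOps.CharExp K p →
  (n : ℕ) (a : Field.Carrier K) → FieldOps.InPowers K (p ^ n) a →
  (α : OrderedAbelianGroup.Carrier Γ) →
  ∀ z → (FieldOps.InPowers K (p ^ n) z → ValuationOps.InQuotientSet V (p ^ n) α a z)
      × (ValuationOps.InQuotientSet V (p ^ n) α a z → FieldOps.InPowers K (p ^ n) z)
lemma4p11 K Γ V _henselian nontrivial p charExp n _ a∈Kᵠ α _ =
  powers⊆quotients nontrivial α a∈Kᵠ , quotients⊆powers α a∈Kᵠ
  where
  open FieldPowers K using (charExp-nonZero; charExp-additive)
  instance
    pⁿ≢0 : NonZero (p ^ n)
    pⁿ≢0 = ℕ.m^n≢0 p n {{charExp-nonZero charExp}}
  open PowerQuotients V (charExp-additive charExp n)
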